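{- Let $(S,=,\#)$ be a set with apartness, $\varepsilon$ an equivalence on $S$ and $\kappa$ a co-equivalence on $S$. (i) $\kappa$ defines an apartness on the factor set $S/\varepsilon$ if and only if $\varepsilon\cap\kappa=\emptyset$. (ii) If $\varepsilon\cap\kappa=\emptyset$ and $S/\varepsilon$ is equipped with the apartness defined by $\kappa$, then the quotient map $\pi:S\to S/\varepsilon$, $\pi(x)=x\varepsilon$, is an se-surjection.
   Context: Constructive (Bishop-style) setting. A set with apartness $(S,=,\#)$: inhabited set with equality $=$ (an equivalence) and $\#$ with $\neg(x\#x)$, $x\#y\Rightarrow y\#x$, $x\#z\Rightarrow\forall y(x\#y\vee y\#z)$; an apartness is extensional w.r.t. the equality ($x\#y\wedge x=x'\wedge y=y'\Rightarrow x'\#y'$). A relation $\kappa$ on $S$ is a co-equivalence if it is symmetric, strongly irreflexive ($(x,y)\in\kappa\Rightarrow x\#y$) and co-transitive ($(x,y)\in\kappa\Rightarrow\forall z((x,z)\in\kappa\vee(z,y)\in\kappa)$). For an equivalence $\varepsilon$ on $S$, $S/\varepsilon$ is the set of classes $x\varepsilon$ with equality $x\varepsilon=y\varepsilon\iff(x,y)\in\varepsilon$. A relation $\alpha$ defines an apartness on $S/\varepsilon$ if the prescription $x\varepsilon\#y\varepsilon:\iff(x,y)\in\alpha$ gives an apartness on the set $(S/\varepsilon,=)$. An se-surjection is a surjective mapping $f$ with $f(x)\#f(y)\Rightarrow x\#y$. -}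

module Defs where

open import Level using (Level; _⊔_; suc)
open import Data.Product using (Σ; _×_; ∃)
open import Data.Sum using (_⊎_)
open import Data.Empty using (⊥)
open import Relation.Nullary using (¬_)
open import Relation.Binary using (Rel; IsEquivalence)

Extensional : ∀ {a ℓ ℓ′} {A : Set a} → Rel A ℓ → Rel A ℓ′ → Set (a ⊔ ℓ ⊔ ℓ′)
Extensional _≈_ R = ∀ {x x′ y y′} → R x y → x ≈ x′ → y ≈ y′ → R x′ y′

record IsApartnessOn {a ℓ ℓ′} {A : Set a} (_≈_ : Rel A ℓ) (_#_ : Rel A ℓ′)
       : Set (a ⊔ ℓ ⊔ ℓ′) where
  field
    irrefl    : ∀ {x} → ¬ (x # x)
    sym       : ∀ {x y} → x # y → y # x
    cotrans   : ∀ {x z} → x # z → ∀ y → (x # y) ⊎ (y # z)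
    extensional : Extensional _≈_ _#_

record SetWithApartness a ℓ : Set (suc (a ⊔ ℓ)) where
  field
    Carrier       : Set a
    _≈_           : Rel Carrier ℓ
    _#_           : Rel Carrier ℓ
    isEquivalence : IsEquivalence _≈_
    isApartness   : IsApartnessOn _≈_ _#_
    inhabitant    : Carrier

module _ {a ℓ} (S : SetWithApartness a ℓ) where
  open SetWithApartness S

  -- An equivalence relation on the set S (a subset of S × S, hence
  -- extensional w.r.t. the equality of S).
  record IsEquivalenceOn (ε : Rel Carrier ℓ) : Set (a ⊔ ℓ) where
    field
      isEquivalence′ : IsEquivalence ε
      extensional    : Extensional _≈_ ε

  record IsCoEquivalence (κ : Rel Carrier ℓ) : Set (a ⊔ ℓ) where
    field
      extensional   : Extensional _≈_ κ
      symmetric     : ∀ {x y} → κ x y → κ y x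
      strongIrrefl  : ∀ {x y} → κ x y → x # y
      cotransitive  : ∀ {x y} → κ x y → ∀ z → κ x z ⊎ κ z y

  Disjoint : Rel Carrier ℓ → Rel Carrier ℓ → Set (a ⊔ ℓ)
  Disjoint ε κ = ∀ {x y} → ε x y → κ x y → ⊥

  -- κ defines an apartness on S/ε: the prescription xε # yε :⇔ (x,y) ∈ κ
  -- is an apartness on the set (S/ε, =), where S/ε is represented by the
  -- carrier of S with equality xε = yε :⇔ (x,y) ∈ ε.
  DefinesApartness : Rel Carrier ℓ → Rel Carrier ℓ → Set (a ⊔ ℓ)
  DefinesApartness ε κ = IsApartnessOn ε κ

  quotient : (ε : Rel Carrier ℓ) → IsEquivalenceOn ε →
             (κ : Rel Carrier ℓ) → DefinesApartness ε κ →
             SetWithApartness a ℓ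
  quotient ε εeq κ κap = record
    { Carrier       = Carrier
    ; _≈_           = ε
    ; _#_           = κ
    ; isEquivalence = IsEquivalenceOn.isEquivalence′ εeq
    ; isApartness   = κap
    ; inhabitant    = inhabitant
    }

-- The quotient map π : S → S/ε, π(x) = xε (identity on representatives).
π : ∀ {a} {A : Set a} → A → A
π x = x

record IsSeSurjection {a ℓ} (A B : SetWithApartness a ℓ)
       (f : SetWithApartness.Carrier A → SetWithApartness.Carrier B)
       : Set (a ⊔ ℓ) where
  private
    module A = SetWithApartness A
    module B = SetWithApartness B
  field
    mapping    : ∀ {x y} → x A.≈ y → f x B.≈ f y
    surjective : ∀ (b : B.Carrier) → ∃ λ x → f x B.≈ b
    strongExt  : ∀ {x y} → f x B.# f y → x A.# y

{-# OPTIONS --safe #-}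
module Submission where

open import Defs
open import Data.Product using (_×_; _,_)
open import Data.Sum using (_⊎_; inj₁; inj₂)
open import Data.Empty using (⊥; ⊥-elim)
open import Function.Bundles using (_⇔_; mk⇔)
open import Relation.Binary using (Rel; IsEquivalence; Symmetric)

-- Split κ x y at x′ and then at y′: each branch other than κ x′ y′ puts an
-- ε-related pair into κ.
cotransitive-disjoint⇒extensional :
  ∀ {a ℓ ℓ′} {A : Set a} {ε : Rel A ℓ} {κ : Rel A ℓ′} →
  Symmetric ε →
  (∀ {x y} → κ x y → ∀ z → κ x z ⊎ κ z y) →
  (∀ {x y} → ε x y → κ x y → ⊥) →
  Extensional ε κ
cotransitive-disjoint⇒extensional ε-sym cotrans disjoint {x′ = x′} {y′ = y′} κxy x≈x′ y≈y′
  with cotrans κxy x′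
... | inj₁ κxx′ = ⊥-elim (disjoint x≈x′ κxx′)
... | inj₂ κx′y with cotrans κx′y y′
...   | inj₁ κx′y′ = κx′y′
...   | inj₂ κy′y = ⊥-elim (disjoint (ε-sym y≈y′) κy′y)

module _ {a ℓ} (S : SetWithApartness a ℓ)
         {ε : Rel (SetWithApartness.Carrier S) ℓ} (εeq : IsEquivalenceOn S ε)
         {κ : Rel (SetWithApartness.Carrier S) ℓ} where

  open SetWithApartness S using (isEquivalence)
  private
    module ε = IsEquivalence (IsEquivalenceOn.isEquivalence′ εeq)

  definesApartness⇒disjoint : DefinesApartness S ε κ → Disjoint S ε κ
  definesApartness⇒disjoint κ-apart x≈y κxy =
    irrefl (extensional κxy x≈y ε.refl)
    where open IsApartnessOn κ-apart

  module _ (κco : IsCoEquivalence S κ) where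
    open IsCoEquivalence κco

    disjoint⇒definesApartness : Disjoint S ε κ → DefinesApartness S ε κ
    disjoint⇒definesApartness disjoint = record
      { irrefl      = disjoint ε.refl
      ; sym         = symmetric
      ; cotrans     = cotransitive
      ; extensional = cotransitive-disjoint⇒extensional ε.sym cotransitive disjoint
      }

    π-isSeSurjection : (κ-apart : DefinesApartness S ε κ) →
                       IsSeSurjection S (quotient S ε εeq κ κ-apart) π
    π-isSeSurjection _ = record
      { mapping    = IsEquivalenceOn.extensional εeq ε.refl (IsEquivalence.refl isEquivalence)
      ; surjective = λ x → x , ε.refl
      ; strongExt  = strongIrrefl
      }

theorem15 : ∀ {a ℓ} (S : SetWithApartness a ℓ)
    (ε : Rel (SetWithApartness.Carrier S) ℓ) (εeq : IsEquivalenceOn S ε)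
    (κ : Rel (SetWithApartness.Carrier S) ℓ) (κco : IsCoEquivalence S κ) →
    (DefinesApartness S ε κ ⇔ Disjoint S ε κ)
    × ((d : Disjoint S ε κ) (h : DefinesApartness S ε κ) →
    IsSeSurjection S (quotient S ε εeq κ h) π)
theorem15 S ε εeq κ κco =
    mk⇔ (definesApartness⇒disjoint S εeq) (disjoint⇒definesApartness S εeq κco)
  , λ _ → π-isSeSurjection S εeq κco
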